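{- Let $a$ and $b$ be relatively prime integers with $a>b\ge 1$, and let $S=\{a,b\}$. The dead ends in $\mathbb{Z}$ with respect to $S$ (equivalently, the maximal Frobenius values with respect to $S$) are as follows. (i) If $a+b$ is even, there are exactly $b-1$ dead ends, they are all strict, they all have length $(a+b)/2$, and they are the integers \[ d=\frac{(a+b)(2\alpha-b)}{2},\qquad \alpha=1,2,\dots,b-1. \] (ii) If $a+b$ is odd, there are exactly $2(b-1)$ dead ends, none of them is strict, they all have length $(a+b-1)/2$, and they are the integers \[ d=\frac{(a+b)(2\alpha-b)\pm b}{2},\qquad \alpha=1,2,\dots,b-1. \]
   Context: For a finite generating set $S$ of $\mathbb{Z}$, the length $\ell(n)$ of $n\in\mathbb{Z}$ is the least $k$ such that $n=s_1+\dots+s_k$ with each $s_i\in S\cup(-S)$ (the distance from $0$ to $n$ in the Cayley graph $\Gamma(\mathbb{Z},S)$, where $m,n$ are adjacent iff $m-n\in S\cup(-S)$). A dead end is an integer $d$ with $\ell(d+s)\le\ell(d)$ for all $s\in S\cup(-S)$; it is strict if $\ell(d+s)<\ell(d)$ for all $s\in S\cup(-S)$. An integer is a Frobenius value with respect to $S$ if it is neither a non-negative nor a non-positive integer linear combination of elements of $S$. The Cayley order: $g\le h$ iff some geodesic in $\Gamma(\mathbb{Z},S)$ from $0$ to $h$ passes through $g$; a maximal Frobenius value is a Frobenius value $c$ such that no Frobenius value $c'\neq c$ satisfies $c\le c'$. -}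

module Defs where

open import Data.Nat using (ℕ; _≤_; _<_)
open import Data.Integer using (ℤ; +_; -_; _+_)
open import Data.List using (List; []; _∷_; length; take)
open import Data.List.Relation.Unary.All using (All)
open import Data.List.Membership.Propositional using (_∈_)
open import Data.Product using (Σ; ∃; _×_)
open import Data.Sum using (_⊎_)
open import Relation.Binary.PropositionalEquality using (_≡_)
open import Relation.Nullary using (¬_)

sumℤ : List ℤ → ℤ
sumℤ [] = + 0
sumℤ (x ∷ xs) = x + sumℤ xs

Step : List ℤ → ℤ → Set
Step S s = s ∈ S ⊎ (- s) ∈ S

Reach : List ℤ → ℤ → ℕ → Set
Reach S n k = Σ (List ℤ) λ w → All (Step S) w × length w ≡ k × sumℤ w ≡ n

Len : List ℤ → ℤ → ℕ → Set
Len S n k = Reach S n k × (∀ k′ → Reach S n k′ → k ≤ k′)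

DeadEnd : List ℤ → ℤ → Set
DeadEnd S d = ∀ s → Step S s → ∀ k k′ → Len S d k → Len S (d + s) k′ → k′ ≤ k

StrictDeadEnd : List ℤ → ℤ → Set
StrictDeadEnd S d = ∀ s → Step S s → ∀ k k′ → Len S d k → Len S (d + s) k′ → k′ < k

NonNegComb : List ℤ → ℤ → Set
NonNegComb S n = Σ (List ℤ) λ w → All (_∈ S) w × sumℤ w ≡ n

Frobenius : List ℤ → ℤ → Set
Frobenius S n = ¬ NonNegComb S n × ¬ NonNegComb S (- n)

-- Cayley order: g ≤ h iff some geodesic from 0 to h passes through g.
-- A path from 0 labelled by the word w visits the partial sums of w;
-- it is a geodesic to h iff sumℤ w ≡ h and length w = ℓ(h).
CayleyLe : List ℤ → ℤ → ℤ → Set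
CayleyLe S g h = Σ (List ℤ) λ w →
  All (Step S) w × sumℤ w ≡ h × Len S h (length w) × ∃ λ i → sumℤ (take i w) ≡ g

MaxFrobenius : List ℤ → ℤ → Set
MaxFrobenius S c = Frobenius S c × (∀ c′ → Frobenius S c′ → CayleyLe S c c′ → c′ ≡ c)

-- Write n = p a + q b with 0 ≤ q < a (Bézout, then division by a). Every other representation is
-- (p + t b, q − t a), and comparing the costs ∣x∣ + ∣y∣ gives ℓ(n) = min (∣p∣ + q, ∣p + b∣ + (a − q)).
-- For p ≥ 0 the step +a, and for p ≤ −b the step −a, raises both candidates, so dead ends lie in
-- the strip −b < p < 0. There the candidates A = ∣p∣ + q and B = ∣p + b∣ + (a − q) satisfy
-- A + B = a + b, and each of the four steps moves one unit between A and B: n is a dead end iff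
-- ∣A − B∣ ≤ 1, a strict one iff A = B, and the parity of a + b fixes A and B. The identity
-- 2n = (a + b)(2α − b) + b(A − B) with α = b − ∣p∣ then gives the values. Balanced strip points have
-- q > 0, and every representation of such a point has coefficients of opposite signs, so they are
-- Frobenius values; an unbalanced Frobenius value has a Frobenius neighbour one step further from 0,
-- so it is not maximal, and no geodesic continues past a dead end.

module Submission where

open import Defs
open import Data.Nat using (ℕ; suc; zero; _≤_; _<_; _∸_; _⊓_; z≤n; s≤s)
import Data.Nat as ℕ
import Data.Nat.Properties as ℕP
open import Data.Nat.Coprimality as ℕC using (Coprime)
import Data.Nat.GCD as ℕGCD
import Data.Nat.Tactic.RingSolver as ℕS
open import Data.Integer as ℤ using (ℤ; +_; -_; _+_; _-_; _*_; ∣_∣; -[1+_])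
import Data.Integer.Properties as ℤP
import Data.Integer.Coprimality as ℤC
import Data.Integer.Divisibility.Signed as ℤD
import Data.Integer.DivMod as ℤDM
open import Data.Integer.Tactic.RingSolver using (solve-∀)
open import Data.List using (List; []; _∷_; [_]; length; take; drop; replicate; _++_; applyUpTo)
import Data.List.Properties as LP
open import Data.List.Relation.Unary.All using (All; []; _∷_; lookup)
import Data.List.Relation.Unary.All.Properties as AllP
open import Data.List.Relation.Unary.Any using (here; there)
open import Data.List.Relation.Unary.Unique.Propositional using (Unique)
import Data.List.Relation.Unary.Unique.Propositional.Properties as UniqueP
open import Data.List.Membership.Propositional using (_∈_)
import Data.List.Membership.Propositional.Properties as ∈P
open import Data.Product using (Σ; ∃; ∃₂; _×_; _,_; proj₁; proj₂)
open import Data.Sum using (_⊎_; inj₁; inj₂)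
open import Data.Sum.Function.Propositional using (_⊎-⇔_)
open import Data.Empty using (⊥-elim)
open import Function using (_∘_; case_of_)
open import Function.Bundles using (_⇔_; mk⇔; Equivalence)
open import Function.Properties.Equivalence using () renaming (trans to ⇔-trans; sym to ⇔-sym)
open import Relation.Binary.Definitions using (tri<; tri≈; tri>)
open import Relation.Binary.PropositionalEquality
  using (_≡_; _≢_; refl; sym; trans; cong; cong₂; subst; subst₂; module ≡-Reasoning)
open import Relation.Nullary using (¬_; yes; no)

-- Words, geodesics and dead ends for an arbitrary generating list

take-length-++ : ∀ {A : Set} (u v : List A) → take (length u) (u ++ v) ≡ u
take-length-++ []      v = refl
take-length-++ (x ∷ u) v = cong (x ∷_) (take-length-++ u v)

sumℤ-++ : ∀ u v → sumℤ (u ++ v) ≡ sumℤ u + sumℤ v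
sumℤ-++ []      v = sym (ℤP.+-identityˡ (sumℤ v))
sumℤ-++ (x ∷ u) v = trans (cong (_+_ x) (sumℤ-++ u v)) (sym (ℤP.+-assoc x (sumℤ u) (sumℤ v)))

sumℤ-∷ʳ : ∀ u s → sumℤ (u ++ [ s ]) ≡ sumℤ u + s
sumℤ-∷ʳ u s = trans (sumℤ-++ u [ s ]) (cong (_+_ (sumℤ u)) (ℤP.+-identityʳ s))

length-∷ʳ : ∀ {A : Set} (u : List A) x → length (u ++ [ x ]) ≡ suc (length u)
length-∷ʳ []      x = refl
length-∷ʳ (_ ∷ u) x = cong suc (length-∷ʳ u x)

sumℤ-replicate : ∀ n s → sumℤ (replicate n s) ≡ + n * s
sumℤ-replicate zero    s = sym (ℤP.*-zeroˡ s)
sumℤ-replicate (suc n) s = trans (cong (_+_ s) (sumℤ-replicate n s)) (sym (ℤP.suc-* (+ n) s))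

module _ {S : List ℤ} where

  step-neg : ∀ {s} → Step S s → Step S (- s)
  step-neg {s} (inj₁ s∈S)  = inj₂ (subst (_∈ S) (sym (ℤP.neg-involutive s)) s∈S)
  step-neg     (inj₂ -s∈S) = inj₁ -s∈S

  reach-++ : ∀ {m n j k} → Reach S m j → Reach S n k → Reach S (m + n) (j ℕ.+ k)
  reach-++ (u , u-steps , refl , refl) (v , v-steps , refl , refl) =
    u ++ v , AllP.++⁺ u-steps v-steps , LP.length-++ u , sumℤ-++ u v

  reach-multiple : ∀ {s} → Step S s → ∀ x → Reach S (x * s) ∣ x ∣
  reach-multiple {s} st (+ n) =
    replicate n s , AllP.replicate⁺ n st , LP.length-replicate n , sumℤ-replicate n s
  reach-multiple {s} st -[1+ n ] =
    replicate (suc n) (- s) , AllP.replicate⁺ (suc n) (step-neg st) , LP.length-replicate (suc n) ,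
    trans (sumℤ-replicate (suc n) (- s))
      (trans (sym (ℤP.neg-distribʳ-* (+ suc n) s)) (ℤP.neg-distribˡ-* (+ suc n) s))

  len-unique : ∀ {n k k′} → Len S n k → Len S n k′ → k ≡ k′
  len-unique (r , min) (r′ , min′) = ℕP.≤-antisym (min _ r′) (min′ _ r)

  deadEnd-intro : ∀ {d k} → Len S d k →
    (∀ s → Step S s → ∃ λ k′ → Len S (d + s) k′ × k′ ≤ k) → DeadEnd S d
  deadEnd-intro ℓd neighbour s st k k′ ℓd′ ℓds with neighbour s st
  ... | _ , ℓds′ , le = subst₂ _≤_ (len-unique ℓds′ ℓds) (len-unique ℓd ℓd′) le

  strictDeadEnd-intro : ∀ {d k} → Len S d k →
    (∀ s → Step S s → ∃ λ k′ → Len S (d + s) k′ × k′ < k) → StrictDeadEnd S d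
  strictDeadEnd-intro ℓd neighbour s st k k′ ℓd′ ℓds with neighbour s st
  ... | _ , ℓds′ , lt = subst₂ _<_ (len-unique ℓds′ ℓds) (len-unique ℓd ℓd′) lt

  deadEnd-no-farther-neighbour : ∀ {d s k} → DeadEnd S d → Step S s →
    Len S d k → ¬ Len S (d + s) (suc k)
  deadEnd-no-farther-neighbour de st ℓd ℓds = ℕP.1+n≰n (de _ st _ _ ℓd ℓds)

  geodesic-prefix : ∀ u v → All (Step S) (u ++ v) →
    Len S (sumℤ (u ++ v)) (length (u ++ v)) → Len S (sumℤ u) (length u)
  geodesic-prefix u v steps (_ , minimal) = (u , AllP.++⁻ˡ u steps , refl , refl) , minimal′
    where
    minimal′ : ∀ k → Reach S (sumℤ u) k → length u ≤ k
    minimal′ k r = ℕP.+-cancelʳ-≤ (length v) (length u) k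
      (subst (_≤ k ℕ.+ length v) (LP.length-++ u)
        (minimal _ (subst (λ n → Reach S n _) (sym (sumℤ-++ u v))
          (reach-++ r (v , AllP.++⁻ʳ u steps , refl , refl)))))

  geodesic-snoc : ∀ u s v → All (Step S) (u ++ s ∷ v) →
    Len S (sumℤ (u ++ s ∷ v)) (length (u ++ s ∷ v)) → Len S (sumℤ u + s) (suc (length u))
  geodesic-snoc u s v steps geo = subst₂ (Len S) (sumℤ-∷ʳ u s) (length-∷ʳ u s)
    (geodesic-prefix (u ++ [ s ]) v (subst (All (Step S)) assoc steps)
      (subst (λ w → Len S (sumℤ w) (length w)) assoc geo))
    where
    assoc : u ++ s ∷ v ≡ (u ++ [ s ]) ++ v
    assoc = sym (LP.++-assoc u [ s ] v)

  deadEnd-geodesic-end : ∀ {d} → DeadEnd S d → ∀ u v → All (Step S) (u ++ v) →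
    Len S (sumℤ (u ++ v)) (length (u ++ v)) → sumℤ u ≡ d → sumℤ (u ++ v) ≡ d
  deadEnd-geodesic-end de u []      _     _   refl = cong sumℤ (LP.++-identityʳ u)
  deadEnd-geodesic-end de u (s ∷ v) steps geo refl = ⊥-elim
    (deadEnd-no-farther-neighbour de (lookup steps (∈P.∈-++⁺ʳ u (here refl)))
      (geodesic-prefix u (s ∷ v) steps geo) (geodesic-snoc u s v steps geo))

  deadEnd⇒cayley-maximal : ∀ {d c} → DeadEnd S d → CayleyLe S d c → c ≡ d
  deadEnd⇒cayley-maximal {d} de (w , steps , refl , geo , i , Σu≡d) =
    subst (λ w → sumℤ w ≡ d) split
      (deadEnd-geodesic-end de (take i w) (drop i w) (subst (All (Step S)) (sym split) steps)
        (subst (λ w → Len S (sumℤ w) (length w)) (sym split) geo) Σu≡d)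
    where
    split : take i w ++ drop i w ≡ w
    split = LP.take++drop≡id i w

  cayleyLe-step : ∀ {c s k} → Step S s → Len S c k → Len S (c + s) (suc k) → CayleyLe S c (c + s)
  cayleyLe-step {s = s} st ((w , steps , refl , refl) , _) ℓcs =
    w ++ [ s ] , AllP.++⁺ steps (st ∷ []) , sumℤ-∷ʳ w s ,
    subst (Len S _) (sym (length-∷ʳ w s)) ℓcs , length w , cong sumℤ (take-length-++ w [ s ])

  maxFrobenius-no-farther-frobenius : ∀ {c s k} → MaxFrobenius S c → Step S s →
    Len S c k → Len S (c + s) (suc k) → ¬ Frobenius S (c + s)
  maxFrobenius-no-farther-frobenius {c} {s} (_ , maximal) st ℓc ℓcs fr =
    ℕP.m≢1+n+m _ {0} (len-unique ℓc (subst (λ n → Len S n _) c+s≡c ℓcs))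
    where
    c+s≡c : c + s ≡ c
    c+s≡c = maximal _ fr (cayleyLe-step st ℓc ℓcs)

⊓-transfer-≤ : ∀ {x y} → x ≤ y → x ⊓ suc y ≤ suc x ⊓ y
⊓-transfer-≤ {x} {y} x≤y =
  ℕP.⊓-glb (ℕP.m≤n⇒m≤1+n (ℕP.m⊓n≤m x (suc y))) (ℕP.≤-trans (ℕP.m⊓n≤m x (suc y)) x≤y)

⊓-transfer-< : ∀ {x y} → x < y → x ⊓ suc y < suc x ⊓ y
⊓-transfer-< {x} {y} x<y =
  ℕP.⊓-glb (ℕP.m⊓n≤m (suc x) (suc (suc y))) (ℕP.≤-trans (ℕP.m⊓n≤m (suc x) (suc (suc y))) x<y)

⊓-transfer-≥ : ∀ {x y} → y ≤ x → suc x ⊓ y ≤ x ⊓ suc y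
⊓-transfer-≥ {x} {y} y≤x =
  ℕP.≤-trans (ℕP.m⊓n≤n (suc x) y) (ℕP.⊓-glb y≤x (ℕP.n≤1+n y))

⊓-transfer-suc : ∀ {x y} → y < x → x ⊓ suc y ≡ suc (suc x ⊓ y)
⊓-transfer-suc {x} {y} y<x =
  trans (ℕP.m≥n⇒m⊓n≡n y<x) (cong suc (sym (ℕP.m≥n⇒m⊓n≡n (ℕP.m≤n⇒m≤1+n (ℕP.<⇒≤ y<x)))))

Balanced : ℕ → ℕ → Set
Balanced A B = A ≤ suc B × B ≤ suc A

half-≤ : ∀ {x y} → x ℕ.+ x ≤ y ℕ.+ y → x ≤ y
half-≤ 2x≤2y = ℕP.≮⇒≥ (λ y<x → ℕP.<⇒≱ (ℕP.+-mono-< y<x y<x) 2x≤2y)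

half-< : ∀ {x y} → x ℕ.+ x < y ℕ.+ y → x < y
half-< 2x<2y = ℕP.≰⇒> (λ y≤x → ℕP.<⇒≱ 2x<2y (ℕP.+-mono-≤ y≤x y≤x))

balanced-cases : ∀ {A B} → Balanced A B → A ≡ B ⊎ A ≡ suc B ⊎ B ≡ suc A
balanced-cases {A} {B} (A≤1+B , B≤1+A) with ℕP.<-cmp A B
... | tri< A<B _ _ = inj₂ (inj₂ (ℕP.≤-antisym B≤1+A A<B))
... | tri≈ _ A≡B _ = inj₁ A≡B
... | tri> _ _ B<A = inj₂ (inj₁ (ℕP.≤-antisym A≤1+B B<A))

double : ∀ n → n ℕ.+ n ≡ 2 ℕ.* n
double n = cong (n ℕ.+_) (sym (ℕP.+-identityʳ n))

balanced-even : ∀ {A B m} → A ℕ.+ B ≡ 2 ℕ.* m → Balanced A B → A ≡ m × B ≡ m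
balanced-even {A} {B} {m} A+B≡2m bal with balanced-cases bal
... | inj₁ refl = A≡m , A≡m
  where
  A≡m : A ≡ m
  A≡m = ℕP.*-cancelˡ-≡ A m 2 (trans (sym (double A)) A+B≡2m)
... | inj₂ (inj₁ refl) = ⊥-elim (ℕP.even≢odd m B (trans (sym A+B≡2m) (cong suc (double B))))
... | inj₂ (inj₂ refl) =
  ⊥-elim (ℕP.even≢odd m A (trans (sym A+B≡2m) (trans (ℕP.+-suc A A) (cong suc (double A)))))

balanced-odd : ∀ {A B m} → A ℕ.+ B ≡ suc (2 ℕ.* m) → Balanced A B →
  (A ≡ m × B ≡ suc m) ⊎ (A ≡ suc m × B ≡ m)
balanced-odd {A} {B} {m} A+B≡1+2m bal with balanced-cases bal
... | inj₁ refl = ⊥-elim (ℕP.even≢odd A m (trans (sym (double A)) A+B≡1+2m))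
... | inj₂ (inj₁ refl) = inj₂ (cong suc B≡m , B≡m)
  where
  B≡m : B ≡ m
  B≡m = ℕP.*-cancelˡ-≡ B m 2 (trans (sym (double B)) (ℕP.suc-injective A+B≡1+2m))
... | inj₂ (inj₂ refl) = inj₁ (A≡m , cong suc A≡m)
  where
  A≡m : A ≡ m
  A≡m = ℕP.*-cancelˡ-≡ A m 2
    (trans (sym (double A)) (ℕP.suc-injective (trans (sym (ℕP.+-suc A A)) A+B≡1+2m)))

InRange : ℕ → (ℕ → Set) → Set
InRange n P = ∃ λ α → 1 ≤ α × α ≤ n × P α

InRange-map : ∀ {n P Q} → (∀ {α} → P α → Q α) → InRange n P → InRange n Q
InRange-map f (α , 1≤α , α≤n , p) = α , 1≤α , α≤n , f p

InRange-cong : ∀ {n P Q} → (∀ {α} → P α ⇔ Q α) → InRange n P ⇔ InRange n Q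
InRange-cong P⇔Q = mk⇔ (InRange-map (Equivalence.to P⇔Q)) (InRange-map (Equivalence.from P⇔Q))

module _ {A : Set} where

  image : (ℕ → A) → ℕ → List A
  image f n = applyUpTo (f ∘ suc) n

  ∈-image : ∀ f n {x} → x ∈ image f n ⇔ InRange n (λ α → x ≡ f α)
  ∈-image f n = mk⇔ to from
    where
    to : ∀ {x} → x ∈ image f n → InRange n (λ α → x ≡ f α)
    to x∈ with ∈P.∈-applyUpTo⁻ (f ∘ suc) x∈
    ... | i , i<n , x≡ = suc i , s≤s z≤n , i<n , x≡
    from : ∀ {x} → InRange n (λ α → x ≡ f α) → x ∈ image f n
    from (suc i , _ , i<n , refl) = ∈P.∈-applyUpTo⁺ (f ∘ suc) i<n

  ∈-image-++ : ∀ f g n {x} → x ∈ image f n ++ image g n ⇔ InRange n (λ α → x ≡ f α ⊎ x ≡ g α)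
  ∈-image-++ f g n = mk⇔ to from
    where
    to : ∀ {x} → x ∈ image f n ++ image g n → InRange n (λ α → x ≡ f α ⊎ x ≡ g α)
    to x∈ with ∈P.∈-++⁻ (image f n) x∈
    ... | inj₁ x∈f = InRange-map inj₁ (Equivalence.to (∈-image f n) x∈f)
    ... | inj₂ x∈g = InRange-map inj₂ (Equivalence.to (∈-image g n) x∈g)
    from : ∀ {x} → InRange n (λ α → x ≡ f α ⊎ x ≡ g α) → x ∈ image f n ++ image g n
    from (α , 1≤α , α≤n , inj₁ x≡) = ∈P.∈-++⁺ˡ (Equivalence.from (∈-image f n) (α , 1≤α , α≤n , x≡))
    from (α , 1≤α , α≤n , inj₂ x≡) =
      ∈P.∈-++⁺ʳ (image f n) (Equivalence.from (∈-image g n) (α , 1≤α , α≤n , x≡))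

  image-unique : ∀ {f} n → (∀ {i j} → f i ≡ f j → i ≡ j) → Unique (image f n)
  image-unique {f} n f-injective =
    UniqueP.applyUpTo⁺₁ (f ∘ suc) n (λ i<j _ → ℕP.<⇒≢ i<j ∘ ℕP.suc-injective ∘ f-injective)

  image-++-unique : ∀ {f g} n → (∀ {i j} → f i ≡ f j → i ≡ j) → (∀ {i j} → g i ≡ g j → i ≡ j) →
    (∀ i j → f i ≢ g j) → Unique (image f n ++ image g n)
  image-++-unique {f} {g} n f-injective g-injective f≢g = UniqueP.++⁺
    (image-unique n f-injective) (image-unique n g-injective) disjoint
    where
    disjoint : ∀ {x} → ¬ (x ∈ image f n × x ∈ image g n)
    disjoint (x∈f , x∈g) with Equivalence.to (∈-image f n) x∈f | Equivalence.to (∈-image g n) x∈g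
    ... | i , _ , _ , x≡fi | j , _ , _ , x≡gj = f≢g i j (trans (sym x≡fi) x≡gj)

neg-flip : ∀ {x y : ℤ} → - x ≡ y → - y ≡ x
neg-flip {x} refl = ℤP.neg-involutive x

double-affine-injective : ∀ K c e (f : ℕ → ℤ) .{{_ : ℤ.NonZero K}} →
  (∀ α → + 2 * f α ≡ K * (+ 2 * + α - c) + e) → ∀ {x y} → f x ≡ f y → x ≡ y
double-affine-injective K c e f 2f≡ {x} {y} fx≡fy =
  ℤP.+-injective (ℤP.i-j≡0⇒i≡j (+ x) (+ y)
    (ℤP.*-cancelˡ-≡ K _ (+ 0) (trans K[x-y]≡0 (sym (ℤP.*-zeroʳ K)))))
  where
  difference : ∀ K c e x y → + 2 * (K * (x - y)) ≡ (K * (+ 2 * x - c) + e) - (K * (+ 2 * y - c) + e)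
  difference = solve-∀
  K[x-y]≡0 : K * (+ x - + y) ≡ + 0
  K[x-y]≡0 = ℤP.*-cancelˡ-≡ (+ 2) _ (+ 0) (begin
    + 2 * (K * (+ x - + y))
      ≡⟨ difference K c e (+ x) (+ y) ⟩
    (K * (+ 2 * + x - c) + e) - (K * (+ 2 * + y - c) + e)
      ≡⟨ cong₂ _-_ (sym (2f≡ x)) (sym (2f≡ y)) ⟩
    + 2 * f x - + 2 * f y
      ≡⟨ cong (λ z → + 2 * z - + 2 * f y) fx≡fy ⟩
    + 2 * f y - + 2 * f y
      ≡⟨ ℤP.+-inverseʳ (+ 2 * f y) ⟩
    + 0 ∎)
    where open ≡-Reasoning

OppositeSigns : ℤ → ℤ → Set
OppositeSigns x y = ∃₂ λ m n → (x ≡ -[1+ m ] × y ≡ + suc n) ⊎ (x ≡ + suc m × y ≡ -[1+ n ])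

nonNegative-not-opposite : ∀ x y → ¬ OppositeSigns (+ x) (+ y)
nonNegative-not-opposite x y (_ , _ , inj₁ (() , _))
nonNegative-not-opposite x y (_ , _ , inj₂ (_ , ()))

nonPositive-not-opposite : ∀ x y → ¬ OppositeSigns (- + x) (- + y)
nonPositive-not-opposite x zero    (_ , _ , inj₁ (_ , ()))
nonPositive-not-opposite x (suc y) (_ , _ , inj₁ (_ , ()))
nonPositive-not-opposite zero    y (_ , _ , inj₂ (() , _))
nonPositive-not-opposite (suc x) y (_ , _ , inj₂ (() , _))

module TwoGenerators (a b : ℕ) (a⊥b : Coprime a b) (b<a : b < a) (1≤b : 1 ≤ b) where

  S : List ℤ
  S = + a ∷ + b ∷ []

  b≤a : b ≤ a
  b≤a = ℕP.<⇒≤ b<a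

  instance
    a-nonZero : ℕ.NonZero a
    a-nonZero = ℕ.>-nonZero (ℕP.<-≤-trans 1≤b b≤a)
    b-nonZero : ℕ.NonZero b
    b-nonZero = ℕ.>-nonZero 1≤b
    a+b-nonZero : ℕ.NonZero (a ℕ.+ b)
    a+b-nonZero = ℕ.>-nonZero (ℕP.<-≤-trans 1≤b (ℕP.m≤n+m b a))

  a-step : Step S (+ a)
  a-step = inj₁ (here refl)

  b-step : Step S (+ b)
  b-step = inj₁ (there (here refl))

  step-elim : (P : ℤ → Set) → P (+ a) → P (+ b) → P (- + a) → P (- + b) → ∀ s → Step S s → P s
  step-elim P pa pb p-a p-b s (inj₁ (here refl))         = pa
  step-elim P pa pb p-a p-b s (inj₁ (there (here refl))) = pb
  step-elim P pa pb p-a p-b s (inj₂ (here -s≡a))         = subst P (neg-flip -s≡a) p-a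
  step-elim P pa pb p-a p-b s (inj₂ (there (here -s≡b))) = subst P (neg-flip -s≡b) p-b

  -- Lengths

  reach-combination : ∀ x y → Reach S (x * + a + y * + b) (∣ x ∣ ℕ.+ ∣ y ∣)
  reach-combination x y = reach-++ (reach-multiple a-step x) (reach-multiple b-step y)

  step-coefficients : ∀ s → Step S s → ∃₂ λ e f → s ≡ e * + a + f * + b × ∣ e ∣ ℕ.+ ∣ f ∣ ≡ 1
  step-coefficients = step-elim _ (+ 1 , + 0 , ua (+ a) (+ b) , refl) (+ 0 , + 1 , ub (+ a) (+ b) , refl)
    (- + 1 , + 0 , u-a (+ a) (+ b) , refl) (+ 0 , - + 1 , u-b (+ a) (+ b) , refl)
    where
    ua : ∀ A B → A ≡ + 1 * A + + 0 * B
    ua = solve-∀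
    ub : ∀ A B → B ≡ + 0 * A + + 1 * B
    ub = solve-∀
    u-a : ∀ A B → - A ≡ - + 1 * A + + 0 * B
    u-a = solve-∀
    u-b : ∀ A B → - B ≡ + 0 * A + - + 1 * B
    u-b = solve-∀

  word-coefficients : ∀ {w} → All (Step S) w →
    ∃₂ λ x y → sumℤ w ≡ x * + a + y * + b × ∣ x ∣ ℕ.+ ∣ y ∣ ≤ length w
  word-coefficients [] = + 0 , + 0 , refl , z≤n
  word-coefficients {s ∷ w} (st ∷ steps) with step-coefficients s st | word-coefficients steps
  ... | e , f , s≡ , ∣e∣+∣f∣≡1 | x , y , Σw≡ , cost≤ =
    e + x , f + y , trans (cong₂ _+_ s≡ Σw≡) (collect e f x y (+ a) (+ b)) , cost-bound
    where
    collect : ∀ e f x y A B → (e * A + f * B) + (x * A + y * B) ≡ (e + x) * A + (f + y) * B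
    collect = solve-∀
    shuffle : ∀ i j k l → (i ℕ.+ j) ℕ.+ (k ℕ.+ l) ≡ (i ℕ.+ k) ℕ.+ (j ℕ.+ l)
    shuffle = ℕS.solve-∀
    cost-bound : ∣ e + x ∣ ℕ.+ ∣ f + y ∣ ≤ suc (length w)
    cost-bound = begin
      ∣ e + x ∣ ℕ.+ ∣ f + y ∣                  ≤⟨ ℕP.+-mono-≤ (ℤP.∣i+j∣≤∣i∣+∣j∣ e x) (ℤP.∣i+j∣≤∣i∣+∣j∣ f y) ⟩
      (∣ e ∣ ℕ.+ ∣ x ∣) ℕ.+ (∣ f ∣ ℕ.+ ∣ y ∣)  ≡⟨ shuffle (∣ e ∣) (∣ x ∣) (∣ f ∣) (∣ y ∣) ⟩
      (∣ e ∣ ℕ.+ ∣ f ∣) ℕ.+ (∣ x ∣ ℕ.+ ∣ y ∣)  ≡⟨ cong (ℕ._+ (∣ x ∣ ℕ.+ ∣ y ∣)) ∣e∣+∣f∣≡1 ⟩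
      suc (∣ x ∣ ℕ.+ ∣ y ∣)                    ≤⟨ s≤s cost≤ ⟩
      suc (length w)                           ∎
      where open ℕP.≤-Reasoning

  combination-shift : ∀ x y p q → x * + a + y * + b ≡ p * + a + q * + b →
    ∃ λ t → x ≡ p + t * + b × y ≡ q - t * + a
  combination-shift x y p q eq = t , x≡ , y≡
    where
    difference : ∀ x y p q A B → (x - p) * A - B * (q - y) ≡ (x * A + y * B) - (p * A + q * B)
    difference = solve-∀
    b[q-y]≡[x-p]a : + b * (q - y) ≡ (x - p) * + a
    b[q-y]≡[x-p]a = sym (ℤP.i-j≡0⇒i≡j _ _ (trans (difference x y p q (+ a) (+ b))
      (trans (cong (_- (p * + a + q * + b)) eq) (ℤP.+-inverseʳ (p * + a + q * + b)))))
    a∣q-y : + a ℤD.∣ (q - y)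
    a∣q-y = ℤD.∣ᵤ⇒∣ (ℤC.coprime-divisor (+ a) (+ b) (q - y) a⊥b (ℤD.∣⇒∣ᵤ (ℤD.divides (x - p) b[q-y]≡[x-p]a)))
    t : ℤ
    t = ℤD._∣_.quotient a∣q-y
    q-y≡ta : q - y ≡ t * + a
    q-y≡ta = ℤD._∣_.equality a∣q-y
    q-[q-y] : ∀ q y → y ≡ q - (q - y)
    q-[q-y] = solve-∀
    p+[x-p] : ∀ p x → x ≡ p + (x - p)
    p+[x-p] = solve-∀
    reorder : ∀ B t A → B * (t * A) ≡ (t * B) * A
    reorder = solve-∀
    y≡ : y ≡ q - t * + a
    y≡ = trans (q-[q-y] q y) (cong (_-_ q) q-y≡ta)
    x-p≡tb : x - p ≡ t * + b
    x-p≡tb = ℤP.*-cancelʳ-≡ (x - p) (t * + b) (+ a) (begin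
      (x - p) * + a  ≡⟨ sym b[q-y]≡[x-p]a ⟩
      + b * (q - y)  ≡⟨ cong (+ b *_) q-y≡ta ⟩
      + b * (t * + a) ≡⟨ reorder (+ b) t (+ a) ⟩
      t * + b * + a  ∎)
      where open ≡-Reasoning
    x≡ : x ≡ p + t * + b
    x≡ = trans (p+[x-p] p x) (cong (_+_ p) x-p≡tb)

  ∣x∣+n≤∣x-sb∣+∣n+sa∣ : ∀ x n s → ∣ x ∣ ℕ.+ n ≤ ∣ x - + s * + b ∣ ℕ.+ ∣ + n + + s * + a ∣
  ∣x∣+n≤∣x-sb∣+∣n+sa∣ x n s = begin
    ∣ x ∣ ℕ.+ n                            ≤⟨ ℕP.+-monoˡ-≤ n triangle ⟩
    ∣ x - + s * + b ∣ ℕ.+ s ℕ.* b ℕ.+ n    ≡⟨ ℕP.+-assoc ∣ x - + s * + b ∣ (s ℕ.* b) n ⟩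
    ∣ x - + s * + b ∣ ℕ.+ (s ℕ.* b ℕ.+ n)  ≤⟨ ℕP.+-monoʳ-≤ ∣ x - + s * + b ∣ (ℕP.+-monoˡ-≤ n sb≤sa) ⟩
    ∣ x - + s * + b ∣ ℕ.+ (s ℕ.* a ℕ.+ n)  ≡⟨ cong (∣ x - + s * + b ∣ ℕ.+_) (ℕP.+-comm (s ℕ.* a) n) ⟩
    ∣ x - + s * + b ∣ ℕ.+ (n ℕ.+ s ℕ.* a)  ≡⟨ cong (λ z → ∣ x - + s * + b ∣ ℕ.+ ∣ + n + z ∣) (ℤP.pos-* s a) ⟩
    ∣ x - + s * + b ∣ ℕ.+ ∣ + n + + s * + a ∣ ∎
    where
    open ℕP.≤-Reasoning
    sb≤sa : s ℕ.* b ≤ s ℕ.* a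
    sb≤sa = ℕP.*-monoʳ-≤ s b≤a
    x≡ : ∀ x y → x ≡ (x - y) + y
    x≡ = solve-∀
    triangle : ∣ x ∣ ≤ ∣ x - + s * + b ∣ ℕ.+ s ℕ.* b
    triangle = subst₂ _≤_ (cong ∣_∣ (sym (x≡ x (+ s * + b))))
      (cong (∣ x - + s * + b ∣ ℕ.+_) (ℤP.abs-* (+ s) (+ b))) (ℤP.∣i+j∣≤∣i∣+∣j∣ (x - + s * + b) (+ s * + b))

  a-q≡r : ∀ {q r} → q ℕ.+ r ≡ a → - (+ q - + a) ≡ + r
  a-q≡r {q} {r} refl = cancel (+ q) (+ r)
    where
    cancel : ∀ q r → - (q - (q + r)) ≡ r
    cancel = solve-∀

  -- Shifts with t ≤ 0 cost at least ∣p∣ + q, those with t ≥ 1 at least ∣p + b∣ + r.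
  shift-cost-≥ : ∀ p q r → q ℕ.+ r ≡ a → ∀ t →
    (∣ p ∣ ℕ.+ q) ⊓ (∣ p + + b ∣ ℕ.+ r) ≤ ∣ p + t * + b ∣ ℕ.+ ∣ + q - t * + a ∣
  shift-cost-≥ p q r q+r≡a = bound
    where
    backward-x : ∀ p s B → p - s * B ≡ p + - s * B
    backward-x = solve-∀
    backward-y : ∀ q s A → q + s * A ≡ q - - s * A
    backward-y = solve-∀
    forward-x : ∀ p s B → - (p + B) - s * B ≡ - (p + (+ 1 + s) * B)
    forward-x = solve-∀
    forward-y : ∀ q s A → - (q - A) + s * A ≡ - (q - (+ 1 + s) * A)
    forward-y = solve-∀
    backward : ∀ s → ∣ p ∣ ℕ.+ q ≤ ∣ p + - + s * + b ∣ ℕ.+ ∣ + q - - + s * + a ∣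
    backward s = subst (∣ p ∣ ℕ.+ q ≤_)
      (cong₂ (λ x y → ∣ x ∣ ℕ.+ ∣ y ∣) (backward-x p (+ s) (+ b)) (backward-y (+ q) (+ s) (+ a)))
      (∣x∣+n≤∣x-sb∣+∣n+sa∣ p q s)
    forward : ∀ s → ∣ p + + b ∣ ℕ.+ r ≤ ∣ p + + suc s * + b ∣ ℕ.+ ∣ + q - + suc s * + a ∣
    forward s = subst₂ _≤_ (cong (ℕ._+ r) (ℤP.∣-i∣≡∣i∣ (p + + b))) (cong₂ ℕ._+_ ∣x∣≡ ∣y∣≡)
      (∣x∣+n≤∣x-sb∣+∣n+sa∣ (- (p + + b)) r s)
      where
      ∣x∣≡ : ∣ - (p + + b) - + s * + b ∣ ≡ ∣ p + + suc s * + b ∣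
      ∣x∣≡ = trans (cong ∣_∣ (forward-x p (+ s) (+ b))) (ℤP.∣-i∣≡∣i∣ (p + + suc s * + b))
      ∣y∣≡ : ∣ + r + + s * + a ∣ ≡ ∣ + q - + suc s * + a ∣
      ∣y∣≡ = trans (cong (λ z → ∣ z + + s * + a ∣) (sym (a-q≡r q+r≡a)))
        (trans (cong ∣_∣ (forward-y (+ q) (+ s) (+ a))) (ℤP.∣-i∣≡∣i∣ (+ q - + suc s * + a)))
    bound : ∀ t → (∣ p ∣ ℕ.+ q) ⊓ (∣ p + + b ∣ ℕ.+ r) ≤ ∣ p + t * + b ∣ ℕ.+ ∣ + q - t * + a ∣
    bound (+ zero)  = ℕP.≤-trans (ℕP.m⊓n≤m _ _) (backward 0)
    bound -[1+ s ]  = ℕP.≤-trans (ℕP.m⊓n≤m _ _) (backward (suc s))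
    bound (+ suc s) = ℕP.≤-trans (ℕP.m⊓n≤n _ _) (forward s)

  representation-cost-≥ : ∀ p q r → q ℕ.+ r ≡ a → ∀ x y → x * + a + y * + b ≡ p * + a + + q * + b →
    (∣ p ∣ ℕ.+ q) ⊓ (∣ p + + b ∣ ℕ.+ r) ≤ ∣ x ∣ ℕ.+ ∣ y ∣
  representation-cost-≥ p q r q+r≡a x y eq =
    let t , x≡ , y≡ = combination-shift x y p (+ q) eq
    in subst₂ (λ x y → (∣ p ∣ ℕ.+ q) ⊓ (∣ p + + b ∣ ℕ.+ r) ≤ ∣ x ∣ ℕ.+ ∣ y ∣) (sym x≡) (sym y≡)
         (shift-cost-≥ p q r q+r≡a t)

  len-combination : ∀ p q r → q ℕ.+ r ≡ a →
    Len S (p * + a + + q * + b) ((∣ p ∣ ℕ.+ q) ⊓ (∣ p + + b ∣ ℕ.+ r))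
  len-combination p q r q+r≡a = reach , minimal
    where
    other-side : ∀ p q A B → (p + B) * A + (q - A) * B ≡ p * A + q * B
    other-side = solve-∀
    reach : Reach S (p * + a + + q * + b) ((∣ p ∣ ℕ.+ q) ⊓ (∣ p + + b ∣ ℕ.+ r))
    reach with ℕP.≤-total (∣ p ∣ ℕ.+ q) (∣ p + + b ∣ ℕ.+ r)
    ... | inj₁ A≤B = subst (Reach S _) (sym (ℕP.m≤n⇒m⊓n≡m A≤B)) (reach-combination p (+ q))
    ... | inj₂ B≤A = subst₂ (Reach S) (other-side p (+ q) (+ a) (+ b))
      (trans (cong (∣ p + + b ∣ ℕ.+_) (trans (sym (ℤP.∣-i∣≡∣i∣ (+ q - + a))) (cong ∣_∣ (a-q≡r q+r≡a))))
             (sym (ℕP.m≥n⇒m⊓n≡n B≤A)))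
      (reach-combination (p + + b) (+ q - + a))
    minimal : ∀ k → Reach S (p * + a + + q * + b) k → (∣ p ∣ ℕ.+ q) ⊓ (∣ p + + b ∣ ℕ.+ r) ≤ k
    minimal k (w , steps , refl , Σw≡) =
      let x , y , Σw≡xa+yb , cost≤ = word-coefficients steps
      in ℕP.≤-trans (representation-cost-≥ p q r q+r≡a x y (trans (sym Σw≡xa+yb) Σw≡)) cost≤

  bézout : ∃₂ λ u v → + 1 ≡ u * + a + v * + b
  bézout = from-ℕ (ℕC.coprime-Bézout a⊥b)
    where
    lift : ∀ x m y n → 1 ℕ.+ y ℕ.* n ≡ x ℕ.* m → + x * + m ≡ + 1 + + y * + n
    lift x m y n eq = trans (sym (ℤP.pos-* x m)) (trans (cong +_ (sym eq)) (cong (_+_ (+ 1)) (ℤP.pos-* y n)))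
    cancelʳ : ∀ y B → + 1 ≡ (+ 1 + y * B) + - y * B
    cancelʳ = solve-∀
    cancelˡ : ∀ x A → + 1 ≡ - x * A + (+ 1 + x * A)
    cancelˡ = solve-∀
    from-ℕ : ℕGCD.Bézout.Identity 1 a b → ∃₂ λ u v → + 1 ≡ u * + a + v * + b
    from-ℕ (ℕGCD.Bézout.+- x y 1+yb≡xa) =
      + x , - + y , trans (cancelʳ (+ y) (+ b)) (cong (_+ - + y * + b) (sym (lift x a y b 1+yb≡xa)))
    from-ℕ (ℕGCD.Bézout.-+ x y 1+xa≡yb) =
      - + x , + y , trans (cancelˡ (+ x) (+ a)) (cong (_+_ (- + x * + a)) (sym (lift y b x a 1+xa≡yb)))

  canonical : ∀ n → ∃₂ λ p q → q < a × n ≡ p * + a + + q * + b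
  canonical n = n * u + k * + b , r , ℤDM.n%ℕd<d (n * v) a , (begin
    n                                    ≡⟨ sym (ℤP.*-identityʳ n) ⟩
    n * + 1                              ≡⟨ cong (_*_ n) 1≡ua+vb ⟩
    n * (u * + a + v * + b)              ≡⟨ distribute n u v (+ a) (+ b) ⟩
    n * u * + a + n * v * + b            ≡⟨ cong (λ z → n * u * + a + z * + b) (ℤDM.a≡a%ℕn+[a/ℕn]*n (n * v) a) ⟩
    n * u * + a + (+ r + k * + a) * + b  ≡⟨ regroup (n * u) (+ r) k (+ a) (+ b) ⟩
    (n * u + k * + b) * + a + + r * + b  ∎)
    where
    open ≡-Reasoning
    u v : ℤ
    u = proj₁ bézout
    v = proj₁ (proj₂ bézout)
    1≡ua+vb : + 1 ≡ u * + a + v * + b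
    1≡ua+vb = proj₂ (proj₂ bézout)
    r : ℕ
    r = (n * v) ℤDM.%ℕ a
    k : ℤ
    k = (n * v) ℤDM./ℕ a
    distribute : ∀ n u v A B → n * (u * A + v * B) ≡ n * u * A + n * v * B
    distribute = solve-∀
    regroup : ∀ nu r k A B → nu * A + (r + k * A) * B ≡ (nu + k * B) * A + r * B
    regroup = solve-∀

  -- The strip

  point : ℕ → ℕ → ℤ
  point P q = - + P * + a + + q * + b

  point-+a : ∀ P q → point (suc P) q + + a ≡ point P q
  point-+a P q = shift (+ P) (+ q) (+ a) (+ b)
    where
    shift : ∀ P q A B → - (+ 1 + P) * A + q * B + A ≡ - P * A + q * B
    shift = solve-∀

  point--a : ∀ P q → point P q + - + a ≡ point (suc P) q
  point--a P q = shift (+ P) (+ q) (+ a) (+ b)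
    where
    shift : ∀ P q A B → - P * A + q * B + - A ≡ - (+ 1 + P) * A + q * B
    shift = solve-∀

  point-+b : ∀ P q → point P q + + b ≡ point P (suc q)
  point-+b P q = shift (+ P) (+ q) (+ a) (+ b)
    where
    shift : ∀ P q A B → - P * A + q * B + B ≡ - P * A + (+ 1 + q) * B
    shift = solve-∀

  point--b : ∀ P q → point P (suc q) + - + b ≡ point P q
  point--b P q = shift (+ P) (+ q) (+ a) (+ b)
    where
    shift : ∀ P q A B → - P * A + (+ 1 + q) * B + - B ≡ - P * A + q * B
    shift = solve-∀

  len-point : ∀ P q {α r} → ∣ - + P + + b ∣ ≡ α → q ℕ.+ r ≡ a → Len S (point P q) ((P ℕ.+ q) ⊓ (α ℕ.+ r))
  len-point P q {α} {r} ∣-P+b∣≡α q+r≡a = subst₂ (λ P′ α′ → Len S (point P q) ((P′ ℕ.+ q) ⊓ (α′ ℕ.+ r)))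
    (ℤP.∣-i∣≡∣i∣ (+ P)) ∣-P+b∣≡α (len-combination (- + P) q r q+r≡a)

  ∣-P+b∣-strip : ∀ P α → P ℕ.+ α ≡ b → ∣ - + P + + b ∣ ≡ α
  ∣-P+b∣-strip P α refl = cong ∣_∣ (cancel (+ P) (+ α))
    where
    cancel : ∀ P α → - P + (P + α) ≡ α
    cancel = solve-∀

  ∣-P+b∣-beyond : ∀ P k → k ℕ.+ b ≡ P → ∣ - + P + + b ∣ ≡ k
  ∣-P+b∣-beyond P k refl = trans (cong ∣_∣ (cancel (+ k) (+ b))) (ℤP.∣-i∣≡∣i∣ (+ k))
    where
    cancel : ∀ k B → - (k + B) + B ≡ - k
    cancel = solve-∀

  -- A and B are the costs of the representations (−P, q) and (α, −r) of d; α is the α of the theorem.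
  record StripPoint (d : ℤ) : Set where
    constructor strip
    field
      P α q r : ℕ
      P+α≡b : P ℕ.+ α ≡ b
      q+r≡a : q ℕ.+ r ≡ a
      1≤P : 1 ≤ P
      1≤α : 1 ≤ α
      d≡point : d ≡ point P q

    A B : ℕ
    A = P ℕ.+ q
    B = α ℕ.+ r

  open StripPoint


  len-strip : ∀ {d} (sp : StripPoint d) → Len S d (A sp ⊓ B sp)
  len-strip (strip P α q r P+α≡b q+r≡a _ _ refl) = len-point P q (∣-P+b∣-strip P α P+α≡b) q+r≡a

  len-stripʳ : ∀ {d} (sp : StripPoint d) → Len S d (B sp ⊓ A sp)
  len-stripʳ sp = subst (Len S _) (ℕP.⊓-comm (A sp) (B sp)) (len-strip sp)

  A+B≡a+b : ∀ {d} (sp : StripPoint d) → A sp ℕ.+ B sp ≡ a ℕ.+ b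
  A+B≡a+b (strip P α q r refl refl _ _ _) = rearrange P α q r
    where
    rearrange : ∀ P α q r → (P ℕ.+ q) ℕ.+ (α ℕ.+ r) ≡ (q ℕ.+ r) ℕ.+ (P ℕ.+ α)
    rearrange = ℕS.solve-∀

  Transfer : ℤ → ℕ → ℕ → Set
  Transfer d′ A B = ∃ λ x → A ≡ suc x × Len S d′ (x ⊓ suc B)

  transfer-≤ : ∀ {d′ A B} → Transfer d′ A B → A ≤ suc B → ∃ λ k → Len S d′ k × k ≤ A ⊓ B
  transfer-≤ (x , refl , ℓ) (s≤s x≤B) = _ , ℓ , ⊓-transfer-≤ x≤B

  transfer-< : ∀ {d′ A B} → Transfer d′ A B → A ≤ B → ∃ λ k → Len S d′ k × k < A ⊓ B
  transfer-< (x , refl , ℓ) x<B = _ , ℓ , ⊓-transfer-< x<B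

  transfer-≥ : ∀ {d′ A B k} → Transfer d′ A B → B < A → Len S d′ k → A ⊓ B ≤ k
  transfer-≥ (x , refl , ℓ) (s≤s B≤x) ℓ′ = subst (_ ≤_) (len-unique ℓ ℓ′) (⊓-transfer-≥ B≤x)

  transfer-suc : ∀ {d′ A B} → Transfer d′ A B → suc B < A → Len S d′ (suc (A ⊓ B))
  transfer-suc (x , refl , ℓ) (s≤s B<x) = subst (Len S _) (⊓-transfer-suc B<x) ℓ

  strip-transfer-+a : ∀ {d} (sp : StripPoint d) → Transfer (d + + a) (A sp) (B sp)
  strip-transfer-+a (strip zero _ _ _ _ _ () _ _)
  strip-transfer-+a (strip (suc P) α q r P+α≡b q+r≡a _ _ refl) = P ℕ.+ q , refl ,
    subst (λ n → Len S n _) (sym (point-+a P q))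
      (len-point P q (∣-P+b∣-strip P (suc α) (trans (ℕP.+-suc P α) P+α≡b)) q+r≡a)

  strip-transfer--a : ∀ {d} (sp : StripPoint d) → Transfer (d + - + a) (B sp) (A sp)
  strip-transfer--a (strip _ zero _ _ _ _ _ () _)
  strip-transfer--a (strip P (suc α) q r P+α≡b q+r≡a _ _ refl) = α ℕ.+ r , refl ,
    subst₂ (Len S) (sym (point--a P q)) (ℕP.⊓-comm (suc P ℕ.+ q) (α ℕ.+ r))
      (len-point (suc P) q (∣-P+b∣-strip (suc P) α (trans (sym (ℕP.+-suc P α)) P+α≡b)) q+r≡a)

  strip-transfer-+b : ∀ {d} (sp : StripPoint d) → 1 ≤ r sp → Transfer (d + + b) (B sp) (A sp)
  strip-transfer-+b (strip _ _ _ zero _ _ _ _ _) ()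
  strip-transfer-+b (strip P α q (suc r) P+α≡b q+r≡a _ _ refl) _ = α ℕ.+ r , ℕP.+-suc α r ,
    subst₂ (Len S) (sym (point-+b P q))
      (trans (ℕP.⊓-comm (P ℕ.+ suc q) (α ℕ.+ r)) (cong (λ A′ → (α ℕ.+ r) ⊓ A′) (ℕP.+-suc P q)))
      (len-point P (suc q) (∣-P+b∣-strip P α P+α≡b) (trans (sym (ℕP.+-suc q r)) q+r≡a))

  strip-transfer--b : ∀ {d} (sp : StripPoint d) → 1 ≤ q sp → Transfer (d + - + b) (A sp) (B sp)
  strip-transfer--b (strip _ _ zero _ _ _ _ _ _) ()
  strip-transfer--b (strip P α (suc q) r P+α≡b q+r≡a _ _ refl) _ = P ℕ.+ q , ℕP.+-suc P q ,
    subst₂ (Len S) (sym (point--b P q)) (cong (λ B′ → (P ℕ.+ q) ⊓ B′) (ℕP.+-suc α r))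
      (len-point P q (∣-P+b∣-strip P α P+α≡b) (trans (ℕP.+-suc q r) q+r≡a))

  transfer-≤ʳ : ∀ {d′ A B} → Transfer d′ B A → B ≤ suc A → ∃ λ k → Len S d′ k × k ≤ A ⊓ B
  transfer-≤ʳ {A = A} {B} tr B≤1+A =
    let k , ℓ , k≤ = transfer-≤ tr B≤1+A in k , ℓ , subst (k ≤_) (ℕP.⊓-comm B A) k≤

  transfer-<ʳ : ∀ {d′ A B} → Transfer d′ B A → B ≤ A → ∃ λ k → Len S d′ k × k < A ⊓ B
  transfer-<ʳ {A = A} {B} tr B≤A =
    let k , ℓ , k< = transfer-< tr B≤A in k , ℓ , subst (k <_) (ℕP.⊓-comm B A) k<

  deadEnd-transfer-≤ : ∀ {d s A B} → DeadEnd S d → Step S s →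
    Len S d (A ⊓ B) → Transfer (d + s) A B → A ≤ suc B
  deadEnd-transfer-≤ de st ℓ tr =
    ℕP.≮⇒≥ (λ 1+B<A → deadEnd-no-farther-neighbour de st ℓ (transfer-suc tr 1+B<A))

  strictDeadEnd-transfer-< : ∀ {d s A B} → StrictDeadEnd S d → Step S s →
    Len S d (A ⊓ B) → Transfer (d + s) A B → A ≤ B
  strictDeadEnd-transfer-< sde st ℓ tr@(_ , _ , ℓ′) =
    ℕP.≮⇒≥ (λ B<A → ℕP.<⇒≱ (sde _ st _ _ ℓ ℓ′) (transfer-≥ tr B<A ℓ′))

  P<b : ∀ {d} (sp : StripPoint d) → P sp < b
  P<b (strip P α _ _ refl _ _ 1≤α _) = ℕP.m<m+n P 1≤α

  α<b : ∀ {d} (sp : StripPoint d) → α sp < b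
  α<b (strip P α _ _ refl _ 1≤P _ _) = ℕP.m<n+m α 1≤P

  balanced⇒interior : ∀ {d} (sp : StripPoint d) → Balanced (A sp) (B sp) → 1 ≤ q sp × 1 ≤ r sp
  balanced⇒interior sp@(strip P α zero r _ r≡a _ _ _) (_ , B≤1+A) = ⊥-elim (ℕP.<-irrefl refl (begin-strict
    a               ≡⟨ sym r≡a ⟩
    r               ≤⟨ ℕP.m≤n+m r α ⟩
    α ℕ.+ r         ≤⟨ B≤1+A ⟩
    suc (P ℕ.+ 0)   ≡⟨ cong suc (ℕP.+-identityʳ P) ⟩
    suc P           ≤⟨ P<b sp ⟩
    b               <⟨ b<a ⟩
    a               ∎))
    where open ℕP.≤-Reasoning
  balanced⇒interior sp@(strip P α q zero _ q+0≡a _ _ _) (A≤1+B , _) = ⊥-elim (ℕP.<-irrefl refl (begin-strict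
    a               ≡⟨ sym (trans (sym (ℕP.+-identityʳ q)) q+0≡a) ⟩
    q               ≤⟨ ℕP.m≤n+m q P ⟩
    P ℕ.+ q         ≤⟨ A≤1+B ⟩
    suc (α ℕ.+ 0)   ≡⟨ cong suc (ℕP.+-identityʳ α) ⟩
    suc α           ≤⟨ α<b sp ⟩
    b               <⟨ b<a ⟩
    a               ∎))
    where open ℕP.≤-Reasoning
  balanced⇒interior (strip _ _ (suc _) (suc _) _ _ _ _ _) _ = s≤s z≤n , s≤s z≤n

  deadEnd⇒balanced : ∀ {d} (sp : StripPoint d) → DeadEnd S d → Balanced (A sp) (B sp)
  deadEnd⇒balanced sp de =
    deadEnd-transfer-≤ de a-step (len-strip sp) (strip-transfer-+a sp) ,
    deadEnd-transfer-≤ de (step-neg a-step) (len-stripʳ sp) (strip-transfer--a sp)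

  balanced⇒deadEnd : ∀ {d} (sp : StripPoint d) → Balanced (A sp) (B sp) → DeadEnd S d
  balanced⇒deadEnd sp bal@(A≤1+B , B≤1+A) = deadEnd-intro (len-strip sp) (step-elim _
    (transfer-≤ (strip-transfer-+a sp) A≤1+B)
    (transfer-≤ʳ (strip-transfer-+b sp (proj₂ (balanced⇒interior sp bal))) B≤1+A)
    (transfer-≤ʳ (strip-transfer--a sp) B≤1+A)
    (transfer-≤ (strip-transfer--b sp (proj₁ (balanced⇒interior sp bal))) A≤1+B))

  equal⇒strictDeadEnd : ∀ {d} (sp : StripPoint d) → A sp ≡ B sp → StrictDeadEnd S d
  equal⇒strictDeadEnd sp A≡B = strictDeadEnd-intro (len-strip sp) (step-elim _
    (transfer-< (strip-transfer-+a sp) A≤B)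
    (transfer-<ʳ (strip-transfer-+b sp (proj₂ interior)) B≤A)
    (transfer-<ʳ (strip-transfer--a sp) B≤A)
    (transfer-< (strip-transfer--b sp (proj₁ interior)) A≤B))
    where
    A≤B : A sp ≤ B sp
    A≤B = ℕP.≤-reflexive A≡B
    B≤A : B sp ≤ A sp
    B≤A = ℕP.≤-reflexive (sym A≡B)
    interior : 1 ≤ q sp × 1 ≤ r sp
    interior = balanced⇒interior sp (ℕP.m≤n⇒m≤1+n A≤B , ℕP.m≤n⇒m≤1+n B≤A)

  strictDeadEnd⇒equal : ∀ {d} (sp : StripPoint d) → StrictDeadEnd S d → A sp ≡ B sp
  strictDeadEnd⇒equal sp sde = ℕP.≤-antisym
    (strictDeadEnd-transfer-< sde a-step (len-strip sp) (strip-transfer-+a sp))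
    (strictDeadEnd-transfer-< sde (step-neg a-step) (len-stripʳ sp) (strip-transfer--a sp))

  -- Dead ends and Frobenius values

  data Region (n : ℤ) : Set where
    positive-cone : ∀ P q r → q ℕ.+ r ≡ a → n ≡ + P * + a + + q * + b → Region n
    negative-cone : ∀ k q r → q ℕ.+ r ≡ a → n ≡ point (k ℕ.+ b) q → Region n
    in-strip      : (sp : StripPoint n) → 1 ≤ r sp → Region n

  region : ∀ n → Region n
  region n = let p , q , q<a , n≡ = canonical n in classify p q q<a n≡
    where
    classify : ∀ p q → q < a → n ≡ p * + a + + q * + b → Region n
    classify (+ P) q q<a n≡ = positive-cone P q (a ∸ q) (ℕP.m+[n∸m]≡n (ℕP.<⇒≤ q<a)) n≡
    classify -[1+ P ] q q<a n≡ with b ℕP.≤? suc P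
    ... | yes b≤P = negative-cone (suc P ∸ b) q (a ∸ q) (ℕP.m+[n∸m]≡n (ℕP.<⇒≤ q<a))
      (trans n≡ (cong (λ P′ → point P′ q) (sym (ℕP.m∸n+n≡m b≤P))))
    ... | no b≰P = in-strip
      (strip (suc P) (b ∸ suc P) q (a ∸ q) (ℕP.m+[n∸m]≡n (ℕP.<⇒≤ 1+P<b)) (ℕP.m+[n∸m]≡n (ℕP.<⇒≤ q<a))
        (s≤s z≤n) (ℕP.m<n⇒0<n∸m 1+P<b) n≡)
      (ℕP.m<n⇒0<n∸m q<a)
      where
      1+P<b : suc P < b
      1+P<b = ℕP.≰⇒> b≰P

  positive-cone-not-deadEnd : ∀ P q r → q ℕ.+ r ≡ a → ¬ DeadEnd S (+ P * + a + + q * + b)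
  positive-cone-not-deadEnd P q r q+r≡a de = deadEnd-no-farther-neighbour de a-step
    (len-combination (+ P) q r q+r≡a)
    (subst (λ n → Len S n _) (sym (shift (+ P) (+ q) (+ a) (+ b))) (len-combination (+ suc P) q r q+r≡a))
    where
    shift : ∀ P q A B → P * A + q * B + A ≡ (+ 1 + P) * A + q * B
    shift = solve-∀

  negative-cone-not-deadEnd : ∀ k q r → q ℕ.+ r ≡ a → ¬ DeadEnd S (point (k ℕ.+ b) q)
  negative-cone-not-deadEnd k q r q+r≡a de = deadEnd-no-farther-neighbour de (step-neg a-step)
    (len-point (k ℕ.+ b) q (∣-P+b∣-beyond (k ℕ.+ b) k refl) q+r≡a)
    (subst (λ n → Len S n _) (sym (point--a (k ℕ.+ b) q))
      (len-point (suc k ℕ.+ b) q (∣-P+b∣-beyond (suc k ℕ.+ b) (suc k) refl) q+r≡a))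

  deadEnd⇒strip : ∀ {d} → DeadEnd S d → StripPoint d
  deadEnd⇒strip {d} de = strip-of (region d)
    where
    strip-of : Region d → StripPoint d
    strip-of (positive-cone P q r q+r≡a d≡) =
      ⊥-elim (positive-cone-not-deadEnd P q r q+r≡a (subst (DeadEnd S) d≡ de))
    strip-of (negative-cone k q r q+r≡a d≡) =
      ⊥-elim (negative-cone-not-deadEnd k q r q+r≡a (subst (DeadEnd S) d≡ de))
    strip-of (in-strip sp _) = sp

  nonNegComb-combination : ∀ x y → NonNegComb S (+ x * + a + + y * + b)
  nonNegComb-combination x y =
    replicate x (+ a) ++ replicate y (+ b) ,
    AllP.++⁺ (AllP.replicate⁺ x (here refl)) (AllP.replicate⁺ y (there (here refl))) ,
    trans (sumℤ-++ (replicate x (+ a)) _) (cong₂ _+_ (sumℤ-replicate x (+ a)) (sumℤ-replicate y (+ b)))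

  nonNegComb-coefficients : ∀ {w} → All (_∈ S) w → ∃₂ λ x y → sumℤ w ≡ + x * + a + + y * + b
  nonNegComb-coefficients [] = 0 , 0 , refl
  nonNegComb-coefficients (here refl ∷ w∈S) =
    let x , y , Σw≡ = nonNegComb-coefficients w∈S
    in suc x , y , trans (cong (_+_ (+ a)) Σw≡) (add-a (+ x) (+ y) (+ a) (+ b))
    where
    add-a : ∀ x y A B → A + (x * A + y * B) ≡ (+ 1 + x) * A + y * B
    add-a = solve-∀
  nonNegComb-coefficients (there (here refl) ∷ w∈S) =
    let x , y , Σw≡ = nonNegComb-coefficients w∈S
    in x , suc y , trans (cong (_+_ (+ b)) Σw≡) (add-b (+ x) (+ y) (+ a) (+ b))
    where
    add-b : ∀ x y A B → B + (x * A + y * B) ≡ x * A + (+ 1 + y) * B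
    add-b = solve-∀

  interior-opposite-signs : ∀ {d} (sp : StripPoint d) → 1 ≤ q sp → 1 ≤ r sp →
    ∀ x y → d ≡ x * + a + y * + b → OppositeSigns x y
  interior-opposite-signs (strip zero _ _ _ _ _ () _ _) _ _ _ _ _
  interior-opposite-signs (strip _ zero _ _ _ _ _ () _) _ _ _ _ _
  interior-opposite-signs (strip _ _ zero _ _ _ _ _ _) () _ _ _ _
  interior-opposite-signs (strip _ _ _ zero _ _ _ _ _) _ () _ _ _
  interior-opposite-signs (strip (suc P) (suc α) (suc q) (suc r) refl refl _ _ refl) _ _ x y d≡ =
    let t , x≡ , y≡ = combination-shift x y (- + suc P) (+ suc q) (sym d≡) in signs t x≡ y≡
    where
    b′ a′ : ℕ
    b′ = suc P ℕ.+ suc α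
    a′ = suc q ℕ.+ suc r
    toward : ∀ P s B → - P + - s * B ≡ - (P + s * B)
    toward = solve-∀
    away : ∀ q s A → q - - s * A ≡ q + s * A
    away = solve-∀
    past-x : ∀ P α s → - P + (+ 1 + s) * (P + α) ≡ α + s * (P + α)
    past-x = solve-∀
    past-y : ∀ q r s → q - (+ 1 + s) * (q + r) ≡ - (r + s * (q + r))
    past-y = solve-∀
    before : ∀ s → x ≡ - + suc P + - + s * + b′ → y ≡ + suc q - - + s * + a′ → OppositeSigns x y
    before s x≡ y≡ = P ℕ.+ s ℕ.* b′ , q ℕ.+ s ℕ.* a′ , inj₁
      ( trans x≡ (trans (toward (+ suc P) (+ s) (+ b′)) (cong (λ z → - (+ suc P + z)) (sym (ℤP.pos-* s b′))))
      , trans y≡ (trans (away (+ suc q) (+ s) (+ a′)) (cong (_+_ (+ suc q)) (sym (ℤP.pos-* s a′)))) )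
    signs : ∀ t → x ≡ - + suc P + t * + b′ → y ≡ + suc q - t * + a′ → OppositeSigns x y
    signs (+ zero)  = before 0
    signs -[1+ s ]  = before (suc s)
    signs (+ suc s) x≡ y≡ = α ℕ.+ s ℕ.* b′ , r ℕ.+ s ℕ.* a′ , inj₂
      ( trans x≡ (trans (past-x (+ suc P) (+ suc α) (+ s)) (cong (_+_ (+ suc α)) (sym (ℤP.pos-* s b′))))
      , trans y≡ (trans (past-y (+ suc q) (+ suc r) (+ s))
                   (cong (λ z → - (+ suc r + z)) (sym (ℤP.pos-* s a′)))) )

  interior⇒frobenius : ∀ {d} (sp : StripPoint d) → 1 ≤ q sp → 1 ≤ r sp → Frobenius S d
  interior⇒frobenius {d} sp 1≤q 1≤r = not-nonNeg , not-nonPos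
    where
    not-nonNeg : ¬ NonNegComb S d
    not-nonNeg (w , w∈S , Σw≡d) =
      let x , y , Σw≡ = nonNegComb-coefficients w∈S
      in nonNegative-not-opposite x y (interior-opposite-signs sp 1≤q 1≤r (+ x) (+ y) (trans (sym Σw≡d) Σw≡))
    distribute : ∀ x y A B → - (x * A + y * B) ≡ - x * A + - y * B
    distribute = solve-∀
    negate : ∀ x y → - d ≡ x * + a + y * + b → d ≡ - x * + a + - y * + b
    negate x y -d≡ = trans (sym (ℤP.neg-involutive d)) (trans (cong -_ -d≡) (distribute x y (+ a) (+ b)))
    not-nonPos : ¬ NonNegComb S (- d)
    not-nonPos (w , w∈S , Σw≡-d) =
      let x , y , Σw≡ = nonNegComb-coefficients w∈S
      in nonPositive-not-opposite x y
           (interior-opposite-signs sp 1≤q 1≤r (- + x) (- + y) (negate (+ x) (+ y) (trans (sym Σw≡-d) Σw≡)))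

  negate-negative-cone : ∀ k q r → q ℕ.+ r ≡ a → - point (k ℕ.+ b) q ≡ + k * + a + + r * + b
  negate-negative-cone k q r refl = negate (+ k) (+ b) (+ q) (+ r)
    where
    negate : ∀ k B q r → - (- (k + B) * (q + r) + q * B) ≡ k * (q + r) + r * B
    negate = solve-∀

  negate-axis : ∀ P → - point P 0 ≡ + P * + a + + 0 * + b
  negate-axis P = negate (+ P) (+ a) (+ b)
    where
    negate : ∀ P A B → - (- P * A + + 0 * B) ≡ P * A + + 0 * B
    negate = solve-∀

  frobenius⇒interior : ∀ {c} → Frobenius S c → Σ (StripPoint c) λ sp → 1 ≤ q sp × 1 ≤ r sp
  frobenius⇒interior {c} (not-nonNeg , not-nonPos) = interior-of (region c)
    where
    nonPos : ∀ x y → - c ≡ + x * + a + + y * + b → NonNegComb S (- c)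
    nonPos x y -c≡ = subst (NonNegComb S) (sym -c≡) (nonNegComb-combination x y)
    interior-of : Region c → Σ (StripPoint c) λ sp → 1 ≤ q sp × 1 ≤ r sp
    interior-of (positive-cone P q _ _ c≡) =
      ⊥-elim (not-nonNeg (subst (NonNegComb S) (sym c≡) (nonNegComb-combination P q)))
    interior-of (negative-cone k q r q+r≡a c≡) =
      ⊥-elim (not-nonPos (nonPos k r (trans (cong -_ c≡) (negate-negative-cone k q r q+r≡a))))
    interior-of (in-strip (strip P _ zero _ _ _ _ _ c≡) _) =
      ⊥-elim (not-nonPos (nonPos P 0 (trans (cong -_ c≡) (negate-axis P))))
    interior-of (in-strip sp@(strip _ _ (suc _) _ _ _ _ _ _) 1≤r) = sp , s≤s z≤n , 1≤r

  strip-+b : ∀ {d} (sp : StripPoint d) → 2 ≤ r sp → Σ (StripPoint (d + + b)) λ sp′ → 1 ≤ q sp′ × 1 ≤ r sp′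
  strip-+b (strip P α q (suc r) P+α≡b q+r≡a 1≤P 1≤α refl) (s≤s 1≤r) =
    strip P α (suc q) r P+α≡b (trans (sym (ℕP.+-suc q r)) q+r≡a) 1≤P 1≤α (point-+b P q) , s≤s z≤n , 1≤r

  strip--b : ∀ {d} (sp : StripPoint d) → 2 ≤ q sp → Σ (StripPoint (d + - + b)) λ sp′ → 1 ≤ q sp′ × 1 ≤ r sp′
  strip--b (strip P α (suc q) r P+α≡b q+r≡a 1≤P 1≤α refl) (s≤s 1≤q) =
    strip P α q (suc r) P+α≡b (trans (ℕP.+-suc q r) q+r≡a) 1≤P 1≤α (point--b P q) , 1≤q , s≤s z≤n

  -- If A > B + 1 (and q > 1), d − b is a Frobenius value one step further from 0.
  maxFrobenius⇒A≤1+B : ∀ {c} (sp : StripPoint c) → 1 ≤ q sp → MaxFrobenius S c → A sp ≤ suc (B sp)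
  maxFrobenius⇒A≤1+B (strip _ _ zero _ _ _ _ _ _) () _
  maxFrobenius⇒A≤1+B sp@(strip P α 1 r _ 1+r≡a _ _ _) _ _ = ℕP.m≤n⇒m≤1+n (begin
    P ℕ.+ 1  ≡⟨ ℕP.+-comm P 1 ⟩
    suc P    ≤⟨ P<b sp ⟩
    b        ≤⟨ ℕP.≤-pred (subst (b <_) (sym 1+r≡a) b<a) ⟩
    r        ≤⟨ ℕP.m≤n+m r α ⟩
    α ℕ.+ r  ∎)
    where open ℕP.≤-Reasoning
  maxFrobenius⇒A≤1+B sp@(strip _ _ (suc (suc _)) _ _ _ _ _ _) 1≤q mf = ℕP.≮⇒≥ λ 1+B<A →
    let sp′ , 1≤q′ , 1≤r′ = strip--b sp (s≤s (s≤s z≤n))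
    in maxFrobenius-no-farther-frobenius mf (step-neg b-step) (len-strip sp)
         (transfer-suc (strip-transfer--b sp 1≤q) 1+B<A) (interior⇒frobenius sp′ 1≤q′ 1≤r′)

  maxFrobenius⇒B≤1+A : ∀ {c} (sp : StripPoint c) → 1 ≤ r sp → MaxFrobenius S c → B sp ≤ suc (A sp)
  maxFrobenius⇒B≤1+A (strip _ _ _ zero _ _ _ _ _) () _
  maxFrobenius⇒B≤1+A sp@(strip P α q 1 _ q+1≡a _ _ _) _ _ = ℕP.m≤n⇒m≤1+n (begin
    α ℕ.+ 1  ≡⟨ ℕP.+-comm α 1 ⟩
    suc α    ≤⟨ α<b sp ⟩
    b        ≤⟨ ℕP.≤-pred (subst (b <_) (trans (sym q+1≡a) (ℕP.+-comm q 1)) b<a) ⟩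
    q        ≤⟨ ℕP.m≤n+m q P ⟩
    P ℕ.+ q  ∎)
    where open ℕP.≤-Reasoning
  maxFrobenius⇒B≤1+A sp@(strip _ _ _ (suc (suc _)) _ _ _ _ _) 1≤r mf = ℕP.≮⇒≥ λ 1+A<B →
    let sp′ , 1≤q′ , 1≤r′ = strip-+b sp (s≤s (s≤s z≤n))
    in maxFrobenius-no-farther-frobenius mf b-step (len-stripʳ sp)
         (transfer-suc (strip-transfer-+b sp 1≤r) 1+A<B) (interior⇒frobenius sp′ 1≤q′ 1≤r′)

  deadEnd⇔maxFrobenius : ∀ d → DeadEnd S d ⇔ MaxFrobenius S d
  deadEnd⇔maxFrobenius d = mk⇔ to from
    where
    to : DeadEnd S d → MaxFrobenius S d
    to de =
      let sp = deadEnd⇒strip de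
          1≤q , 1≤r = balanced⇒interior sp (deadEnd⇒balanced sp de)
      in interior⇒frobenius sp 1≤q 1≤r , λ _ _ d≤c → deadEnd⇒cayley-maximal de d≤c
    from : MaxFrobenius S d → DeadEnd S d
    from mf@(frobenius , _) =
      let sp , 1≤q , 1≤r = frobenius⇒interior frobenius
      in balanced⇒deadEnd sp (maxFrobenius⇒A≤1+B sp 1≤q mf , maxFrobenius⇒B≤1+A sp 1≤r mf)

  -- Explicit dead ends

  doubled : ℕ → ℕ → ℕ → ℤ
  doubled α A B = (+ a + + b) * (+ 2 * + α - + b) + + b * (+ A - + B)

  double-strip : ∀ {d} (sp : StripPoint d) → + 2 * d ≡ doubled (α sp) (A sp) (B sp)
  double-strip (strip P α q r refl refl _ _ refl) = identity (+ P) (+ α) (+ q) (+ r)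
    where
    identity : ∀ P α q r → + 2 * (- P * (q + r) + q * (P + α)) ≡
      ((q + r) + (P + α)) * (+ 2 * α - (P + α)) + (P + α) * ((P + q) - (α + r))
    identity = solve-∀

  strip-at : ∀ {α A B} → 1 ≤ α → α < b → b ≤ A → A ≤ a → A ℕ.+ B ≡ a ℕ.+ b →
    ∃ λ d → Σ (StripPoint d) λ sp → StripPoint.α sp ≡ α × StripPoint.A sp ≡ A × StripPoint.B sp ≡ B
  strip-at {α} {A} {B} 1≤α α<b b≤A A≤a A+B≡ = _ , sp , refl , P+q≡A , α+r≡B
    where
    P′ q′ : ℕ
    P′ = b ∸ α
    q′ = A ∸ P′
    q′≤a : q′ ≤ a
    q′≤a = ℕP.≤-trans (ℕP.m∸n≤m A P′) A≤a
    sp : StripPoint (point P′ q′)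
    sp = strip P′ α q′ (a ∸ q′) (ℕP.m∸n+n≡m (ℕP.<⇒≤ α<b)) (ℕP.m+[n∸m]≡n q′≤a) (ℕP.m<n⇒0<n∸m α<b) 1≤α refl
    P+q≡A : P′ ℕ.+ q′ ≡ A
    P+q≡A = ℕP.m+[n∸m]≡n (ℕP.≤-trans (ℕP.m∸n≤m b α) b≤A)
    α+r≡B : α ℕ.+ (a ∸ q′) ≡ B
    α+r≡B = ℕP.+-cancelˡ-≡ A _ _
      (trans (cong (ℕ._+ StripPoint.B sp) (sym P+q≡A)) (trans (A+B≡a+b sp) (sym A+B≡)))

  doubled⇒deadEnd : ∀ {d α A B} → 1 ≤ α → α < b → b ≤ A → A ≤ a → A ℕ.+ B ≡ a ℕ.+ b → Balanced A B →
    + 2 * d ≡ doubled α A B → DeadEnd S d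
  doubled⇒deadEnd {d} 1≤α α<b b≤A A≤a A+B≡ bal 2d≡ = case strip-at 1≤α α<b b≤A A≤a A+B≡ of λ where
    (d₀ , sp , refl , refl , refl) →
      subst (DeadEnd S) (ℤP.*-cancelˡ-≡ (+ 2) d₀ d (trans (double-strip sp) (sym 2d≡)))
        (balanced⇒deadEnd sp bal)

  α-range : ∀ {d} (sp : StripPoint d) → 1 ≤ α sp × α sp ≤ b ∸ 1
  α-range sp = 1≤α sp , ℕP.<⇒≤pred (α<b sp)

  module Even (m : ℕ) (a+b≡2m : a ℕ.+ b ≡ 2 ℕ.* m) where

    a+b≡m+m : a ℕ.+ b ≡ m ℕ.+ m
    a+b≡m+m = trans a+b≡2m (sym (double m))

    b<m : b < m
    b<m = half-< (subst (b ℕ.+ b <_) a+b≡m+m (ℕP.+-monoˡ-< b b<a))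

    m≤a : m ≤ a
    m≤a = half-≤ (subst (_≤ a ℕ.+ a) a+b≡m+m (ℕP.+-monoʳ-≤ a b≤a))

    deadEndValue : ℕ → ℤ
    deadEndValue α = + m * (+ 2 * + α - + b)

    double-value : ∀ α → + 2 * deadEndValue α ≡ (+ a + + b) * (+ 2 * + α - + b)
    double-value α = trans (sym (ℤP.*-assoc (+ 2) (+ m) _)) (cong (_* (+ 2 * + α - + b)) (sym K≡2m))
      where
      K≡2m : + a + + b ≡ + 2 * + m
      K≡2m = trans (cong +_ a+b≡2m) (ℤP.pos-* 2 m)

    doubled-balanced : ∀ α → doubled α m m ≡ (+ a + + b) * (+ 2 * + α - + b)
    doubled-balanced α = cancel (+ a + + b) (+ 2 * + α - + b) (+ b) (+ m)
      where
      cancel : ∀ K X B M → K * X + B * (M - M) ≡ K * X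
      cancel = solve-∀

    double⇔value : ∀ {d} α → (+ 2 * d ≡ (+ a + + b) * (+ 2 * + α - + b)) ⇔ (d ≡ deadEndValue α)
    double⇔value {d} α = mk⇔
      (λ 2d≡ → ℤP.*-cancelˡ-≡ (+ 2) d _ (trans 2d≡ (sym (double-value α))))
      (λ { refl → double-value α })

    balanced⇒values : ∀ {d} (sp : StripPoint d) → Balanced (A sp) (B sp) → A sp ≡ m × B sp ≡ m
    balanced⇒values sp = balanced-even (trans (A+B≡a+b sp) a+b≡2m)

    deadEnd⇔value : ∀ d → DeadEnd S d ⇔ InRange (b ∸ 1) (λ α → d ≡ deadEndValue α)
    deadEnd⇔value d = mk⇔ to from
      where
      to : DeadEnd S d → InRange (b ∸ 1) (λ α → d ≡ deadEndValue α)
      to de =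
        let sp = deadEnd⇒strip de
            A≡m , B≡m = balanced⇒values sp (deadEnd⇒balanced sp de)
            1≤α , α≤ = α-range sp
        in α sp , 1≤α , α≤ , Equivalence.to (double⇔value (α sp))
             (trans (double-strip sp) (trans (cong₂ (doubled (α sp)) A≡m B≡m) (doubled-balanced (α sp))))
      from : InRange (b ∸ 1) (λ α → d ≡ deadEndValue α) → DeadEnd S d
      from (α , 1≤α , α≤ , d≡) = doubled⇒deadEnd 1≤α (ℕP.m≤pred[n]⇒suc[m]≤n α≤) (ℕP.<⇒≤ b<m) m≤a (sym a+b≡m+m)
        (ℕP.n≤1+n m , ℕP.n≤1+n m) (trans (Equivalence.from (double⇔value α) d≡) (sym (doubled-balanced α)))

    value-injective : ∀ {x y} → deadEndValue x ≡ deadEndValue y → x ≡ y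
    value-injective = double-affine-injective (+ a + + b) (+ b) (+ 0) deadEndValue
      (λ α → trans (double-value α) (sym (ℤP.+-identityʳ _)))

    deadEnd-list : Σ (List ℤ) λ L → Unique L × length L ≡ b ∸ 1 × (∀ d → DeadEnd S d ⇔ d ∈ L)
    deadEnd-list = image deadEndValue (b ∸ 1) , image-unique (b ∸ 1) value-injective ,
      LP.length-applyUpTo _ (b ∸ 1) , λ d → ⇔-trans (deadEnd⇔value d) (⇔-sym (∈-image deadEndValue (b ∸ 1)))

    deadEnd-strict : ∀ d → DeadEnd S d → StrictDeadEnd S d
    deadEnd-strict d de =
      let sp = deadEnd⇒strip de
          A≡m , B≡m = balanced⇒values sp (deadEnd⇒balanced sp de)
      in equal⇒strictDeadEnd sp (trans A≡m (sym B≡m))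

    deadEnd-length : ∀ d → DeadEnd S d → Len S d m
    deadEnd-length d de =
      let sp = deadEnd⇒strip de
          A≡m , B≡m = balanced⇒values sp (deadEnd⇒balanced sp de)
      in subst (Len S d) (trans (cong₂ _⊓_ A≡m B≡m) (ℕP.⊓-idem m)) (len-strip sp)

    deadEnd⇔formula : ∀ d → DeadEnd S d ⇔ InRange (b ∸ 1) (λ α → + 2 * d ≡ (+ a + + b) * (+ 2 * + α - + b))
    deadEnd⇔formula d = ⇔-trans (deadEnd⇔value d) (InRange-cong λ {α} → ⇔-sym (double⇔value α))

  not-multiple : ∀ z → (+ a + + b) * z ≢ + b
  not-multiple z K*z≡b with ∣ z ∣ | trans (sym (ℤP.abs-* (+ a + + b) z)) (cong ∣_∣ K*z≡b)
  ... | zero  | [a+b]*0≡b = ℕP.<-irrefl (trans (sym (ℕP.*-zeroʳ (a ℕ.+ b))) [a+b]*0≡b) 1≤b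
  ... | suc k | [a+b]*[1+k]≡b = ℕP.<-irrefl refl (begin-strict
    b                       <⟨ ℕP.m<n+m b (ℕP.<-≤-trans 1≤b b≤a) ⟩
    a ℕ.+ b                 ≤⟨ ℕP.m≤m*n (a ℕ.+ b) (suc k) ⟩
    (a ℕ.+ b) ℕ.* suc k     ≡⟨ [a+b]*[1+k]≡b ⟩
    b                       ∎)
    where open ℕP.≤-Reasoning

  module Odd (m : ℕ) (a+b≡1+2m : a ℕ.+ b ≡ suc (2 ℕ.* m)) where

    a+b≡1+m+m : a ℕ.+ b ≡ suc (m ℕ.+ m)
    a+b≡1+m+m = trans a+b≡1+2m (cong suc (sym (double m)))

    b≤m : b ≤ m
    b≤m = half-≤ (ℕP.≤-pred (subst (b ℕ.+ b <_) a+b≡1+m+m (ℕP.+-monoˡ-< b b<a)))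

    m<a : m < a
    m<a = half-≤ (subst (_≤ a ℕ.+ a) (trans (cong suc a+b≡1+m+m) (cong suc (sym (ℕP.+-suc m m))))
      (ℕP.+-monoʳ-< a b<a))

    value₊ value₋ : ℕ → ℤ
    value₊ α = + m * (+ 2 * + α - + b) + + α
    value₋ α = value₊ α - + b

    K≡1+2m : + a + + b ≡ + 2 * + m + + 1
    K≡1+2m = trans (cong +_ (trans a+b≡1+2m (ℕP.+-comm 1 (2 ℕ.* m)))) (cong (_+ + 1) (ℤP.pos-* 2 m))

    double-value₊ : ∀ α → + 2 * value₊ α ≡ (+ a + + b) * (+ 2 * + α - + b) + + b
    double-value₊ α = trans (identity (+ m) (+ α) (+ b))
      (cong (λ K → K * (+ 2 * + α - + b) + + b) (sym K≡1+2m))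
      where
      identity : ∀ M α B → + 2 * (M * (+ 2 * α - B) + α) ≡ (+ 2 * M + + 1) * (+ 2 * α - B) + B
      identity = solve-∀

    double-value₋ : ∀ α → + 2 * value₋ α ≡ (+ a + + b) * (+ 2 * + α - + b) - + b
    double-value₋ α = trans (identity (+ m) (+ α) (+ b))
      (cong (λ K → K * (+ 2 * + α - + b) - + b) (sym K≡1+2m))
      where
      identity : ∀ M α B → + 2 * (M * (+ 2 * α - B) + α - B) ≡ (+ 2 * M + + 1) * (+ 2 * α - B) - B
      identity = solve-∀

    doubled-excess : ∀ α → doubled α (suc m) m ≡ (+ a + + b) * (+ 2 * + α - + b) + + b
    doubled-excess α = simplify (+ a + + b) (+ 2 * + α - + b) (+ b) (+ m)
      where
      simplify : ∀ K X B M → K * X + B * ((+ 1 + M) - M) ≡ K * X + B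
      simplify = solve-∀

    doubled-deficit : ∀ α → doubled α m (suc m) ≡ (+ a + + b) * (+ 2 * + α - + b) - + b
    doubled-deficit α = simplify (+ a + + b) (+ 2 * + α - + b) (+ b) (+ m)
      where
      simplify : ∀ K X B M → K * X + B * (M - (+ 1 + M)) ≡ K * X - B
      simplify = solve-∀

    double⇔value₊ : ∀ {d} α → (+ 2 * d ≡ (+ a + + b) * (+ 2 * + α - + b) + + b) ⇔ (d ≡ value₊ α)
    double⇔value₊ {d} α = mk⇔
      (λ 2d≡ → ℤP.*-cancelˡ-≡ (+ 2) d _ (trans 2d≡ (sym (double-value₊ α))))
      (λ { refl → double-value₊ α })

    double⇔value₋ : ∀ {d} α → (+ 2 * d ≡ (+ a + + b) * (+ 2 * + α - + b) - + b) ⇔ (d ≡ value₋ α)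
    double⇔value₋ {d} α = mk⇔
      (λ 2d≡ → ℤP.*-cancelˡ-≡ (+ 2) d _ (trans 2d≡ (sym (double-value₋ α))))
      (λ { refl → double-value₋ α })

    balanced⇒values : ∀ {d} (sp : StripPoint d) → Balanced (A sp) (B sp) →
      (A sp ≡ m × B sp ≡ suc m) ⊎ (A sp ≡ suc m × B sp ≡ m)
    balanced⇒values sp = balanced-odd (trans (A+B≡a+b sp) a+b≡1+2m)

    deadEnd⇔value : ∀ d → DeadEnd S d ⇔ InRange (b ∸ 1) (λ α → d ≡ value₊ α ⊎ d ≡ value₋ α)
    deadEnd⇔value d = mk⇔ to from
      where
      to : DeadEnd S d → InRange (b ∸ 1) (λ α → d ≡ value₊ α ⊎ d ≡ value₋ α)
      to de = let 1≤α , α≤ = α-range sp in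
        α sp , 1≤α , α≤ , by-values (balanced⇒values sp (deadEnd⇒balanced sp de))
        where
        sp : StripPoint d
        sp = deadEnd⇒strip de
        by-values : (A sp ≡ m × B sp ≡ suc m) ⊎ (A sp ≡ suc m × B sp ≡ m) →
          d ≡ value₊ (α sp) ⊎ d ≡ value₋ (α sp)
        by-values (inj₁ (A≡m , B≡1+m)) = inj₂ (Equivalence.to (double⇔value₋ (α sp))
          (trans (double-strip sp) (trans (cong₂ (doubled (α sp)) A≡m B≡1+m) (doubled-deficit (α sp)))))
        by-values (inj₂ (A≡1+m , B≡m)) = inj₁ (Equivalence.to (double⇔value₊ (α sp))
          (trans (double-strip sp) (trans (cong₂ (doubled (α sp)) A≡1+m B≡m) (doubled-excess (α sp)))))
      from : InRange (b ∸ 1) (λ α → d ≡ value₊ α ⊎ d ≡ value₋ α) → DeadEnd S d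
      from (α , 1≤α , α≤ , inj₁ d≡) = doubled⇒deadEnd 1≤α (ℕP.m≤pred[n]⇒suc[m]≤n α≤) (ℕP.m≤n⇒m≤1+n b≤m) m<a
        (sym a+b≡1+m+m) (ℕP.≤-refl , ℕP.m≤n⇒m≤1+n (ℕP.n≤1+n m))
        (trans (Equivalence.from (double⇔value₊ α) d≡) (sym (doubled-excess α)))
      from (α , 1≤α , α≤ , inj₂ d≡) = doubled⇒deadEnd 1≤α (ℕP.m≤pred[n]⇒suc[m]≤n α≤) b≤m (ℕP.<⇒≤ m<a)
        (trans (ℕP.+-suc m m) (sym a+b≡1+m+m)) (ℕP.m≤n⇒m≤1+n (ℕP.n≤1+n m) , ℕP.≤-refl)
        (trans (Equivalence.from (double⇔value₋ α) d≡) (sym (doubled-deficit α)))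

    values-disjoint : ∀ i j → value₊ i ≢ value₋ j
    values-disjoint i j v₊≡v₋ =
      not-multiple (+ j - + i) (ℤP.i-j≡0⇒i≡j _ _ (ℤP.*-cancelˡ-≡ (+ 2) _ (+ 0) (begin
      + 2 * ((+ a + + b) * (+ j - + i) - + b)
        ≡⟨ identity (+ a + + b) (+ i) (+ j) (+ b) ⟩
      ((+ a + + b) * (+ 2 * + j - + b) - + b) - ((+ a + + b) * (+ 2 * + i - + b) + + b)
        ≡⟨ cong₂ _-_ (sym (double-value₋ j)) (sym (double-value₊ i)) ⟩
      + 2 * value₋ j - + 2 * value₊ i
        ≡⟨ cong (λ v → + 2 * value₋ j - + 2 * v) v₊≡v₋ ⟩
      + 2 * value₋ j - + 2 * value₋ j
        ≡⟨ ℤP.+-inverseʳ (+ 2 * value₋ j) ⟩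
      + 0 ∎)))
      where
      open ≡-Reasoning
      identity : ∀ K i j B → + 2 * (K * (j - i) - B) ≡ (K * (+ 2 * j - B) - B) - (K * (+ 2 * i - B) + B)
      identity = solve-∀

    deadEnd-list : Σ (List ℤ) λ L → Unique L × length L ≡ 2 ℕ.* (b ∸ 1) × (∀ d → DeadEnd S d ⇔ d ∈ L)
    deadEnd-list = image value₊ (b ∸ 1) ++ image value₋ (b ∸ 1) ,
      image-++-unique (b ∸ 1)
        (double-affine-injective (+ a + + b) (+ b) (+ b) value₊ double-value₊)
        (double-affine-injective (+ a + + b) (+ b) (- + b) value₋ double-value₋)
        values-disjoint ,
      trans (LP.length-++ (image value₊ (b ∸ 1)))
        (trans (cong₂ ℕ._+_ (LP.length-applyUpTo _ (b ∸ 1)) (LP.length-applyUpTo _ (b ∸ 1)))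
          (double (b ∸ 1))) ,
      λ d → ⇔-trans (deadEnd⇔value d) (⇔-sym (∈-image-++ value₊ value₋ (b ∸ 1)))

    deadEnd-not-strict : ∀ d → DeadEnd S d → ¬ StrictDeadEnd S d
    deadEnd-not-strict d de sde = ℕP.even≢odd (A sp) m (trans (sym (double (A sp)))
      (trans (cong (A sp ℕ.+_) (strictDeadEnd⇒equal sp sde)) (trans (A+B≡a+b sp) a+b≡1+2m)))
      where
      sp : StripPoint d
      sp = deadEnd⇒strip de

    deadEnd-length : ∀ d → DeadEnd S d → Len S d m
    deadEnd-length d de =
      subst (Len S d) (min≡m (balanced⇒values sp (deadEnd⇒balanced sp de))) (len-strip sp)
      where
      sp : StripPoint d
      sp = deadEnd⇒strip de
      min≡m : (A sp ≡ m × B sp ≡ suc m) ⊎ (A sp ≡ suc m × B sp ≡ m) → A sp ⊓ B sp ≡ m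
      min≡m (inj₁ (A≡m , B≡1+m)) = trans (cong₂ _⊓_ A≡m B≡1+m) (ℕP.m≤n⇒m⊓n≡m (ℕP.n≤1+n m))
      min≡m (inj₂ (A≡1+m , B≡m)) = trans (cong₂ _⊓_ A≡1+m B≡m) (ℕP.m≥n⇒m⊓n≡n (ℕP.n≤1+n m))

    deadEnd⇔formula : ∀ d → DeadEnd S d ⇔ InRange (b ∸ 1) (λ α →
      + 2 * d ≡ (+ a + + b) * (+ 2 * + α - + b) + + b ⊎ + 2 * d ≡ (+ a + + b) * (+ 2 * + α - + b) - + b)
    deadEnd⇔formula d = ⇔-trans (deadEnd⇔value d)
      (InRange-cong λ {α} → ⇔-sym (double⇔value₊ α ⊎-⇔ double⇔value₋ α))

theorem2 : (a b : ℕ) → Coprime a b → b < a → 1 ≤ b →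
  let S = (+ a) ∷ (+ b) ∷ [] in
  (∀ d → DeadEnd S d ⇔ MaxFrobenius S d)
  × (∀ m → a Data.Nat.+ b ≡ 2 Data.Nat.* m →
      (Σ (List ℤ) λ L → Unique L × length L ≡ b ∸ 1 × (∀ d → DeadEnd S d ⇔ d ∈ L))
      × (∀ d → DeadEnd S d → StrictDeadEnd S d)
      × (∀ d → DeadEnd S d → Len S d m)
      × (∀ d → DeadEnd S d ⇔
           (∃ λ α → 1 ≤ α × α ≤ b ∸ 1 ×
             (+ 2) * d ≡ (+ a + + b) * ((+ 2) * (+ α) - + b))))
  × (∀ m → a Data.Nat.+ b ≡ suc (2 Data.Nat.* m) →
      (Σ (List ℤ) λ L → Unique L × length L ≡ 2 Data.Nat.* (b ∸ 1) × (∀ d → DeadEnd S d ⇔ d ∈ L))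
      × (∀ d → DeadEnd S d → ¬ StrictDeadEnd S d)
      × (∀ d → DeadEnd S d → Len S d m)
      × (∀ d → DeadEnd S d ⇔
           (∃ λ α → 1 ≤ α × α ≤ b ∸ 1 ×
             ((+ 2) * d ≡ (+ a + + b) * ((+ 2) * (+ α) - + b) + + b
              ⊎ (+ 2) * d ≡ (+ a + + b) * ((+ 2) * (+ α) - + b) - + b))))
theorem2 a b a⊥b b<a 1≤b =
  deadEnd⇔maxFrobenius ,
  (λ m a+b≡2m → let open Even m a+b≡2m in
    deadEnd-list , deadEnd-strict , deadEnd-length , deadEnd⇔formula) ,
  (λ m a+b≡1+2m → let open Odd m a+b≡1+2m in
    deadEnd-list , deadEnd-not-strict , deadEnd-length , deadEnd⇔formula)
  where open TwoGenerators a b a⊥b b<a 1≤b
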